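{- Let $I_1$ be an instance of the setup class model, $\varepsilon\in(0,1/2]$ with $1/\varepsilon\in\mathbb{Z}$ and $T>0$, such that every job $j$ of $I_1$ whose class has setup time $s_{k_j}<\varepsilon^3T$ has processing time $p_j\ge\varepsilon T$. Let $I_2$ be the instance obtained from $I_1$ by increasing the setup time of every class $k$ with $s_k<\varepsilon^3T$ to $\varepsilon^3T$. Then for all $T',L'$, a $(T',L')$-schedule for $I_1$ induces a $((1+\varepsilon^2)T',L')$-schedule for $I_2$, and a $(T',L')$-schedule for $I_2$ is also a $(T',L')$-schedule for $I_1$.
   Context: Setup class model: jobs $\mathcal{J}$, $m$ identical machines, classes; job $j$ has processing time $p_j>0$ and class $k_j$; class $k$ has setup time $s_k>0$. A schedule is an assignment $\sigma:\mathcal{J}\to[m]$; the load of machine $i$ is $\sum_{j\in\sigma^{ -1}(i)}p_j+\sum_{k\in\{k_j:j\in\sigma^{ -1}(i)\}}s_k$; the makespan is the maximum load. A $(T',L')$-schedule is a schedule with makespan at most $T'$ and free space $\sum_i(T'-\text{load}_i)\ge L'$. In the paper, $I_1$ arises from an instance by deleting all jobs with $s_{k_j}<\varepsilon^3T$ and $p_j<\varepsilon T$.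
   Formalization: The processing times $p_j$, the setup times $s_k$ and the parameters ε, T, T' and L' all take values in the rationals. -}

module Defs where

open import Data.Nat using (ℕ)
open import Data.Fin using (Fin; _≟_)
open import Data.Fin.Properties using (any?)
open import Data.List using (List; foldr; map; allFin)
open import Data.Product using (∃; _×_; _,_)
open import Data.Bool using (if_then_else_)
open import Relation.Nullary using (does; _×-dec_)
open import Relation.Binary.PropositionalEquality using (_≡_)
open import Data.Rational using (ℚ; 0ℚ; _+_; _-_; _*_; _≤_; _<_)
open import Data.Rational.Properties using (_<?_)

sumℚ : List ℚ → ℚ
sumℚ = foldr _+_ 0ℚ

Σℚ : (n : ℕ) → (Fin n → ℚ) → ℚ
Σℚ n f = sumℚ (map f (allFin n))

record Instance : Set where
  field
    nJobs    : ℕ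
    nClasses : ℕ
    m        : ℕ
    p        : Fin nJobs → ℚ
    cls      : Fin nJobs → Fin nClasses
    s        : Fin nClasses → ℚ
open Instance public

Schedule : Instance → Set
Schedule I = Fin (nJobs I) → Fin (m I)

load : (I : Instance) → Schedule I → Fin (m I) → ℚ
load I σ i =
  Σℚ (nJobs I) (λ j → if does (σ j ≟ i) then p I j else 0ℚ)
  + Σℚ (nClasses I) (λ k →
      if does (any? (λ j → (σ j ≟ i) ×-dec (cls I j ≟ k))) then s I k else 0ℚ)

IsTLSchedule : (I : Instance) → Schedule I → ℚ → ℚ → Set
IsTLSchedule I σ T' L' =
  (∀ i → load I σ i ≤ T') × (L' ≤ Σℚ (m I) (λ i → T' - load I σ i))

raiseSetups : Instance → ℚ → Instance
raiseSetups I b = record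
  { nJobs = nJobs I ; nClasses = nClasses I ; m = m I ; p = p I ; cls = cls I
  ; s = λ k → if does (s I k <? b) then b else s I k }

-- Raising the setup of a class k to b = ε³T only happens when s_k < b, and
-- then every job of class k is long: p_j ≥ εT, so b ≤ ε²·p_j. On each
-- machine a class contributes its setup only if one of its jobs is there, so
-- the extra setup time of the class is charged to that job, and a machine's
-- load grows by at most ε² times its processing load, hence by at most ε²T'.
-- The free space on each machine therefore does not shrink when T' becomes
-- (1 + ε²)T'. Conversely, raising setup times never decreases a load.
module Submission where

open import Defs
open import Data.Nat using (ℕ; zero; suc)
open import Data.Integer using (+_)
open import Data.Fin using (Fin; _≟_) renaming (zero to fzero; suc to fsuc)
open import Data.Fin.Properties using (any?)
open import Data.List using (tabulate)
open import Data.List.Properties using (map-tabulate)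
open import Data.Product using (∃; _×_; _,_)
open import Data.Bool using (true; false; if_then_else_)
open import Data.Vec.Functional using (removeAt)
open import Function using (id)
open import Relation.Nullary using (Dec; does; yes; no; _×-dec_)
open import Relation.Nullary.Decidable using (dec-true)
open import Relation.Binary.PropositionalEquality
  using (_≡_; refl; sym; trans; cong; cong₂; subst; subst₂)
open import Data.Rational
  using (ℚ; 0ℚ; 1ℚ; ½; _/_; _+_; _*_; _-_; -_; _≤_; _<_; nonNegative)
open import Data.Rational.Properties
  using ( ≤-refl; ≤-trans; <⇒≤; _<?_; +-mono-≤; +-monoˡ-≤; +-monoʳ-≤
        ; neg-antimono-≤; *-monoˡ-≤-nonNeg; +-identityˡ; +-identityʳ; +-inverseʳ
        ; +-assoc; *-assoc; *-zeroʳ; *-identityˡ; *-distribʳ-+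
        ; +-*-commutativeRing; module ≤-Reasoning)
open import Data.Rational.Solver using (module +-*-Solver)
open import Algebra.Bundles using (CommutativeRing)
open import Algebra.Properties.Semiring.Sum (CommutativeRing.semiring +-*-commutativeRing)
  using (sum; sum-cong-≗; sum-replicate-zero; sum-remove; ∑-distrib-+; ∑-comm; *-distribˡ-sum)

p≤p+q : ∀ {p q} → 0ℚ ≤ q → p ≤ p + q
p≤p+q {p} {q} 0≤q = subst (_≤ p + q) (+-identityʳ p) (+-monoʳ-≤ p 0≤q)

p≤q+p : ∀ {p q} → 0ℚ ≤ q → p ≤ q + p
p≤q+p {p} {q} 0≤q = subst (_≤ q + p) (+-identityˡ p) (+-monoˡ-≤ p 0≤q)

p≤q⇒0≤q-p : ∀ {p q} → p ≤ q → 0ℚ ≤ q - p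
p≤q⇒0≤q-p {p} {q} p≤q = subst (_≤ q - p) (+-inverseʳ p) (+-monoˡ-≤ (- p) p≤q)

0≤q-p⇒p≤q : ∀ {p q} → 0ℚ ≤ q - p → p ≤ q
0≤q-p⇒p≤q {p} {q} 0≤q-p = subst (p ≤_) p+[q-p]≡q (p≤p+q 0≤q-p)
  where
  open +-*-Solver
  p+[q-p]≡q : p + (q - p) ≡ q
  p+[q-p]≡q = solve 2 (λ p q → p :+ (q :- p) := q) refl p q

y≤x+d⇒r-x≤r+d-y : ∀ {x y} d r → y ≤ x + d → r - x ≤ (r + d) - y
y≤x+d⇒r-x≤r+d-y {x} {y} d r y≤x+d =
  subst (r - x ≤_) (sym split) (p≤p+q (p≤q⇒0≤q-p y≤x+d))
  where
  open +-*-Solver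
  split : (r + d) - y ≡ (r - x) + ((x + d) - y)
  split = solve 4 (λ r d x y → (r :+ d) :- y := (r :- x) :+ ((x :+ d) :- y)) refl r d x y

*-monoˡ-≤-nonNeg′ : ∀ {c x y} → 0ℚ ≤ c → x ≤ y → c * x ≤ c * y
*-monoˡ-≤-nonNeg′ {c} 0≤c = *-monoˡ-≤-nonNeg c {{nonNegative 0≤c}}

nonNeg*nonNeg : ∀ {c x} → 0ℚ ≤ c → 0ℚ ≤ x → 0ℚ ≤ c * x
nonNeg*nonNeg {c} {x} 0≤c 0≤x = subst (_≤ c * x) (*-zeroʳ c) (*-monoˡ-≤-nonNeg′ 0≤c 0≤x)

if-mono-≤ : ∀ b {x y} → x ≤ y → (if b then x else 0ℚ) ≤ (if b then y else 0ℚ)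
if-mono-≤ true  x≤y = x≤y
if-mono-≤ false _   = ≤-refl

if-nonNeg : ∀ b {x} → 0ℚ ≤ x → 0ℚ ≤ (if b then x else 0ℚ)
if-nonNeg true  0≤x = 0≤x
if-nonNeg false _   = ≤-refl

Σℚ≡sum : ∀ n (f : Fin n → ℚ) → Σℚ n f ≡ sum f
Σℚ≡sum n f = trans (cong sumℚ (map-tabulate id f)) (sumℚ-tabulate f)
  where
  sumℚ-tabulate : ∀ {n} (g : Fin n → ℚ) → sumℚ (tabulate g) ≡ sum g
  sumℚ-tabulate {zero}  g = refl
  sumℚ-tabulate {suc n} g = cong (_+_ (g fzero)) (sumℚ-tabulate (λ k → g (fsuc k)))

sum-mono-≤ : ∀ {n} {f g : Fin n → ℚ} → (∀ k → f k ≤ g k) → sum f ≤ sum g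
sum-mono-≤ {zero}  _   = ≤-refl
sum-mono-≤ {suc n} f≤g = +-mono-≤ (f≤g fzero) (sum-mono-≤ (λ k → f≤g (fsuc k)))

sum-nonNeg : ∀ {n} {f : Fin n → ℚ} → (∀ k → 0ℚ ≤ f k) → 0ℚ ≤ sum f
sum-nonNeg {n} {f} 0≤f = subst (_≤ sum f) (sum-replicate-zero n) (sum-mono-≤ 0≤f)

≤-sum : ∀ {n} {f : Fin n → ℚ} → (∀ k → 0ℚ ≤ f k) → ∀ k → f k ≤ sum f
≤-sum {suc n} {f} 0≤f k =
  subst (f k ≤_) (sym (sum-remove {i = k} f))
    (p≤p+q (sum-nonNeg {f = removeAt f k} (λ l → 0≤f _)))

sum-if : ∀ {n} b (f : Fin n → ℚ) →
  sum (λ k → if b then f k else 0ℚ) ≡ (if b then sum f else 0ℚ)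
sum-if     true  f = refl
sum-if {n} false f = sum-replicate-zero n

sum-if-≟ : ∀ {n} (c : Fin n) x → sum (λ k → if does (c ≟ k) then x else 0ℚ) ≡ x
sum-if-≟ {suc n} fzero    x = trans (cong (_+_ x) (sum-replicate-zero n)) (+-identityʳ x)
sum-if-≟         (fsuc c) x = trans (+-identityˡ _) (sum-if-≟ c x)

-- IsTLSchedule I σ T L unfolds to Fits (m I) (load I σ) T L.
Fits : (n : ℕ) → (Fin n → ℚ) → ℚ → ℚ → Set
Fits n ℓ T L = (∀ i → ℓ i ≤ T) × (L ≤ Σℚ n (λ i → T - ℓ i))

Fits-freeSpace-mono : ∀ {n} {ℓ₁ ℓ₂ : Fin n → ℚ} {T₁ T₂ L} →
  (∀ i → T₁ - ℓ₁ i ≤ T₂ - ℓ₂ i) → Fits n ℓ₁ T₁ L → Fits n ℓ₂ T₂ L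
Fits-freeSpace-mono {n} free (ℓ₁≤T₁ , L≤free) =
    (λ i → 0≤q-p⇒p≤q (≤-trans (p≤q⇒0≤q-p (ℓ₁≤T₁ i)) (free i)))
  , ≤-trans L≤free (subst₂ _≤_ (sym (Σℚ≡sum n _)) (sym (Σℚ≡sum n _)) (sum-mono-≤ free))

module _ (I : Instance) (σ : Schedule I) (i : Fin (m I)) where

  present? : (k : Fin (nClasses I)) → Dec (∃ λ j → σ j ≡ i × cls I j ≡ k)
  present? k = any? (λ j → (σ j ≟ i) ×-dec (cls I j ≟ k))

  processing : Fin (nJobs I) → ℚ
  processing j = if does (σ j ≟ i) then p I j else 0ℚ

  setup : (Fin (nClasses I) → ℚ) → Fin (nClasses I) → ℚ
  setup t k = if does (present? k) then t k else 0ℚ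

  jobLoad : ℚ
  jobLoad = sum processing

  setupLoad : (Fin (nClasses I) → ℚ) → ℚ
  setupLoad t = sum (setup t)

  classProcessing : Fin (nClasses I) → Fin (nJobs I) → ℚ
  classProcessing k j =
    if does (σ j ≟ i) then (if does (cls I j ≟ k) then p I j else 0ℚ) else 0ℚ

  classProcessing-nonNeg : (∀ j → 0ℚ ≤ p I j) → ∀ k j → 0ℚ ≤ classProcessing k j
  classProcessing-nonNeg 0≤p k j =
    if-nonNeg (does (σ j ≟ i)) (if-nonNeg (does (cls I j ≟ k)) (0≤p j))

  classLoad : Fin (nClasses I) → ℚ
  classLoad k = sum (classProcessing k)

  load≡jobLoad+setupLoad : load I σ i ≡ jobLoad + setupLoad (s I)
  load≡jobLoad+setupLoad =
    cong₂ _+_ (Σℚ≡sum (nJobs I) processing) (Σℚ≡sum (nClasses I) (setup (s I)))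

  sum-classLoad : sum classLoad ≡ jobLoad
  sum-classLoad = trans (∑-comm classProcessing) (sum-cong-≗ collapse)
    where
    collapse : ∀ j → sum (λ k → classProcessing k j) ≡ processing j
    collapse j = trans (sum-if (does (σ j ≟ i)) (λ k → if does (cls I j ≟ k) then p I j else 0ℚ))
      (cong (λ x → if does (σ j ≟ i) then x else 0ℚ) (sum-if-≟ (cls I j) (p I j)))

  ≤-classLoad : (∀ j → 0ℚ ≤ p I j) → ∀ {j} → σ j ≡ i → p I j ≤ classLoad (cls I j)
  ≤-classLoad 0≤p {j} σj≡i =
    subst (_≤ classLoad (cls I j)) termj≡pj (≤-sum (classProcessing-nonNeg 0≤p (cls I j)) j)
    where
    termj≡pj : classProcessing (cls I j) j ≡ p I j
    termj≡pj rewrite dec-true (σ j ≟ i) σj≡i | dec-true (cls I j ≟ cls I j) refl = refl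

  classLoad-nonNeg : (∀ j → 0ℚ ≤ p I j) → ∀ k → 0ℚ ≤ classLoad k
  classLoad-nonNeg 0≤p k = sum-nonNeg (classProcessing-nonNeg 0≤p k)

  setupLoad-mono : ∀ {t u} → (∀ k → t k ≤ u k) → setupLoad t ≤ setupLoad u
  setupLoad-mono t≤u = sum-mono-≤ (λ k → if-mono-≤ (does (present? k)) (t≤u k))

  jobLoad≤load : (∀ k → 0ℚ ≤ s I k) → jobLoad ≤ load I σ i
  jobLoad≤load 0≤s = subst (jobLoad ≤_) (sym load≡jobLoad+setupLoad)
    (p≤p+q (sum-nonNeg (λ k → if-nonNeg (does (present? k)) (0≤s k))))

  setupLoad-≤ : ∀ {c} {t u} → 0ℚ ≤ c → (∀ j → 0ℚ ≤ p I j)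
    → (∀ j → σ j ≡ i → u (cls I j) ≤ t (cls I j) + c * p I j)
    → setupLoad u ≤ setupLoad t + c * jobLoad
  setupLoad-≤ {c} {t} {u} 0≤c 0≤p u≤t+cp = begin
    setupLoad u                                ≤⟨ sum-mono-≤ perClass ⟩
    sum (λ k → setup t k + c * classLoad k)    ≡⟨ ∑-distrib-+ (setup t) _ ⟩
    setupLoad t + sum (λ k → c * classLoad k)
      ≡⟨ cong (_+_ (setupLoad t)) (sym (*-distribˡ-sum c classLoad)) ⟩
    setupLoad t + c * sum classLoad            ≡⟨ cong (λ x → setupLoad t + c * x) sum-classLoad ⟩
    setupLoad t + c * jobLoad                  ∎
    where
    open ≤-Reasoning
    perClass : ∀ k → (if does (present? k) then u k else 0ℚ)
                   ≤ (if does (present? k) then t k else 0ℚ) + c * classLoad k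
    perClass k with present? k
    ... | no  _ = p≤p+q (nonNeg*nonNeg 0≤c (classLoad-nonNeg 0≤p k))
    ... | yes (j , σj≡i , refl) = ≤-trans (u≤t+cp j σj≡i)
          (+-monoʳ-≤ (t (cls I j)) (*-monoˡ-≤-nonNeg′ 0≤c (≤-classLoad 0≤p σj≡i)))

raise : ℚ → ℚ → ℚ
raise b x = if does (x <? b) then b else x

x≤raise : ∀ b x → x ≤ raise b x
x≤raise b x = byCases (x <? b)
  where
  byCases : (x<b? : Dec (x < b)) → x ≤ (if does x<b? then b else x)
  byCases (yes x<b) = <⇒≤ x<b
  byCases (no  _)   = ≤-refl

raise≤ : ∀ {b x y} → (x < b → b ≤ y) → x ≤ y → raise b x ≤ y
raise≤ {b} {x} {y} b≤y x≤y = byCases (x <? b)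
  where
  byCases : (x<b? : Dec (x < b)) → (if does x<b? then b else x) ≤ y
  byCases (yes x<b) = b≤y x<b
  byCases (no  _)   = x≤y

load-≤-raiseSetups : ∀ I b σ i → load I σ i ≤ load (raiseSetups I b) σ i
load-≤-raiseSetups I b σ i =
  subst₂ _≤_ (sym (load≡jobLoad+setupLoad I σ i))
             (sym (load≡jobLoad+setupLoad (raiseSetups I b) σ i))
    (+-monoʳ-≤ (jobLoad I σ i) (setupLoad-mono I σ i (λ k → x≤raise b (s I k))))

raiseSetups-load-≤ : ∀ I b {c} σ i → 0ℚ ≤ c
  → (∀ j → 0ℚ ≤ p I j) → (∀ k → 0ℚ ≤ s I k)
  → (∀ j → s I (cls I j) < b → b ≤ c * p I j)
  → load (raiseSetups I b) σ i ≤ load I σ i + c * jobLoad I σ i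
raiseSetups-load-≤ I b {c} σ i 0≤c 0≤p 0≤s short⇒cheap = begin
  load (raiseSetups I b) σ i                   ≡⟨ load≡jobLoad+setupLoad (raiseSetups I b) σ i ⟩
  P + setupLoad I σ i (λ k → raise b (s I k))  ≤⟨ +-monoʳ-≤ P (setupLoad-≤ I σ i 0≤c 0≤p raised≤) ⟩
  P + (setupLoad I σ i (s I) + c * P)          ≡⟨ sym (+-assoc P _ _) ⟩
  P + setupLoad I σ i (s I) + c * P            ≡⟨ cong (_+ c * P) (sym (load≡jobLoad+setupLoad I σ i)) ⟩
  load I σ i + c * P                           ∎
  where
  open ≤-Reasoning
  P = jobLoad I σ i
  raised≤ : ∀ j → σ j ≡ i → raise b (s I (cls I j)) ≤ s I (cls I j) + c * p I j
  raised≤ j _ = raise≤ (λ short → ≤-trans (short⇒cheap j short) (p≤q+p (0≤s (cls I j))))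
                       (p≤p+q (nonNeg*nonNeg 0≤c (0≤p j)))

lemma6 : (I₁ : Instance) (ε T : ℚ)
  → 0ℚ < ε → ε ≤ ½ → (∃ λ (N : ℕ) → 1ℚ ≡ ε * (+ N / 1))
  → 0ℚ < T
  → (∀ j → 0ℚ < p I₁ j) → (∀ k → 0ℚ < s I₁ k)
  → (∀ j → s I₁ (cls I₁ j) < ε * ε * ε * T → ε * T ≤ p I₁ j)
  → (∀ (T' L' : ℚ) (σ : Schedule I₁)
      → (IsTLSchedule I₁ σ T' L'
          → IsTLSchedule (raiseSetups I₁ (ε * ε * ε * T)) σ ((1ℚ + ε * ε) * T') L')
      × (IsTLSchedule (raiseSetups I₁ (ε * ε * ε * T)) σ T' L'
          → IsTLSchedule I₁ σ T' L'))
lemma6 I ε T 0<ε _ _ _ 0<p 0<s short⇒long T' L' σ = stretch , restrict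
  where
  b = ε * ε * ε * T
  0≤p : ∀ j → 0ℚ ≤ p I j
  0≤p j = <⇒≤ (0<p j)
  0≤s : ∀ k → 0ℚ ≤ s I k
  0≤s k = <⇒≤ (0<s k)
  0≤ε² : 0ℚ ≤ ε * ε
  0≤ε² = nonNeg*nonNeg (<⇒≤ 0<ε) (<⇒≤ 0<ε)
  short⇒cheap : ∀ j → s I (cls I j) < b → b ≤ ε * ε * p I j
  short⇒cheap j short =
    subst (_≤ _) (sym (*-assoc (ε * ε) ε T)) (*-monoˡ-≤-nonNeg′ 0≤ε² (short⇒long j short))
  growth : ∀ i → load I σ i ≤ T' → load (raiseSetups I b) σ i ≤ load I σ i + ε * ε * T'
  growth i ℓ≤T' = ≤-trans (raiseSetups-load-≤ I b σ i 0≤ε² 0≤p 0≤s short⇒cheap)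
    (+-monoʳ-≤ (load I σ i) (*-monoˡ-≤-nonNeg′ 0≤ε² (≤-trans (jobLoad≤load I σ i 0≤s) ℓ≤T')))
  [1+ε²]T'≡T'+ε²T' : (1ℚ + ε * ε) * T' ≡ T' + ε * ε * T'
  [1+ε²]T'≡T'+ε²T' = trans (*-distribʳ-+ T' 1ℚ (ε * ε)) (cong (_+ ε * ε * T') (*-identityˡ T'))
  stretch : IsTLSchedule I σ T' L' → IsTLSchedule (raiseSetups I b) σ ((1ℚ + ε * ε) * T') L'
  stretch fits@(ℓ≤T' , _) = Fits-freeSpace-mono
    (λ i → subst (λ r → T' - load I σ i ≤ r - load (raiseSetups I b) σ i) (sym [1+ε²]T'≡T'+ε²T')
                 (y≤x+d⇒r-x≤r+d-y (ε * ε * T') T' (growth i (ℓ≤T' i))))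
    fits
  restrict : IsTLSchedule (raiseSetups I b) σ T' L' → IsTLSchedule I σ T' L'
  restrict = Fits-freeSpace-mono
    (λ i → +-monoʳ-≤ T' (neg-antimono-≤ (load-≤-raiseSetups I b σ i)))
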